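{- Let $\mathcal{P}=\{2413, 2431, 4213, 3412, 3421, 4231, 4321, 4312\}$, let $I_k=12\cdots k$, and let $n\geq 4$. There are exactly $n-3$ inflations of $3142$ of length $n$ avoiding $\mathcal{P}$, namely $3142[1, I_\ell, I_{n-\ell-2}, 1]$ for $\ell\in[n-3]$.
   Context: For a $k$-permutation $\sigma$ and permutations $\alpha^{(1)},\dots,\alpha^{(k)}$, the inflation $\sigma[\alpha^{(1)},\dots,\alpha^{(k)}]$ replaces each entry $\sigma_\ell$ by a block of consecutive positions order-isomorphic to $\alpha^{(\ell)}$ whose values form an interval, the blocks being ordered relative to each other as the entries of $\sigma$. Pattern containment is the usual order-isomorphic subsequence containment. -}

module Defs where

open import Data.Nat using (ℕ; _+_; _<_; _≤_; _∸_)
open import Data.List using (List; []; _∷_; map; zip; concatMap; length; upTo; filter)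
open import Data.List.Membership.Propositional using (_∈_)
open import Data.List.Relation.Unary.All using (All)
open import Data.List.Relation.Binary.Permutation.Propositional using (_↭_)
open import Data.List.Relation.Binary.Sublist.Propositional using (_⊆_)
open import Data.Product using (Σ; ∃; _×_; _,_; proj₁; proj₂)
open import Function.Bundles using (_⇔_)
open import Relation.Binary.PropositionalEquality using (_≡_; _≢_)
open import Relation.Nullary using (¬_)
open import Data.Nat using (_<?_)
open import Data.Nat.ListAction using (sum)

-- A permutation of length n is a list that is a rearrangement of 0,1,...,n-1
-- (values are 0-based; only the relative order matters for patterns).
IsPerm : ℕ → List ℕ → Set
IsPerm n π = π ↭ upTo n

OrdIso : List ℕ → List ℕ → Set
OrdIso xs ys = Σ (List (ℕ × ℕ)) λ ps →
  map proj₁ ps ≡ xs × map proj₂ ps ≡ ys ×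
  (∀ {p q} → p ∈ ps → q ∈ ps → (proj₁ p < proj₁ q) ⇔ (proj₂ p < proj₂ q))

Contains : List ℕ → List ℕ → Set
Contains π τ = ∃ λ σ → σ ⊆ π × OrdIso σ τ

Avoids : List ℕ → List (List ℕ) → Set
Avoids π P = ∀ {τ} → τ ∈ P → ¬ Contains π τ

-- Inflation σ[α₁,…,α_k]: block ℓ is α_ℓ shifted by the total size of the
-- blocks α_j with σ_j < σ_ℓ; blocks are concatenated in position order.
offset : List (ℕ × List ℕ) → ℕ → ℕ
offset ps v = sum (map (λ p → length (proj₂ p)) (filter (λ p → proj₁ p <? v) ps))

inflate : List ℕ → List (List ℕ) → List ℕ
inflate σ αs = concatMap (λ p → map (offset ps (proj₁ p) +_) (proj₂ p)) ps
  where ps = zip σ αs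

IsInflationOf : List ℕ → List ℕ → Set
IsInflationOf σ π = Σ (List (List ℕ)) λ αs →
  length αs ≡ length σ ×
  All (λ α → α ≢ [] × IsPerm (length α) α) αs ×
  π ≡ inflate σ αs

𝒫 : List (List ℕ)
𝒫 = (2 ∷ 4 ∷ 1 ∷ 3 ∷ []) ∷ (2 ∷ 4 ∷ 3 ∷ 1 ∷ []) ∷ (4 ∷ 2 ∷ 1 ∷ 3 ∷ []) ∷
    (3 ∷ 4 ∷ 1 ∷ 2 ∷ []) ∷ (3 ∷ 4 ∷ 2 ∷ 1 ∷ []) ∷ (4 ∷ 2 ∷ 3 ∷ 1 ∷ []) ∷
    (4 ∷ 3 ∷ 2 ∷ 1 ∷ []) ∷ (4 ∷ 3 ∷ 1 ∷ 2 ∷ []) ∷ []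

σ3142 : List ℕ
σ3142 = 3 ∷ 1 ∷ 4 ∷ 2 ∷ []

I : ℕ → List ℕ
I k = upTo k

special : ℕ → ℕ → List ℕ
special n ℓ = inflate σ3142 ((0 ∷ []) ∷ I ℓ ∷ I (n ∸ ℓ ∸ 2) ∷ (0 ∷ []) ∷ [])

-- Write the inflation as 3142[α₁, α₂, α₃, α₄]; its blocks occupy the value ranges in the order
-- α₂ < α₄ < α₁ < α₃. Avoiding 𝒫 forces the blocks to be trivial or increasing: two entries of α₁
-- together with an entry of α₂ and one of α₄ form 3412 or 4312; an entry of α₁, one of α₃ and two
-- of α₄ form 3412 or 3421; a descent in α₂ gives 4213 and a descent in α₃ gives 2431. So α₁ = α₄ = 1
-- and α₂, α₃ are identities, i.e. π = 3142[1, I_ℓ, I_m, 1] with ℓ + m + 2 = n.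
-- Conversely, with 0-based values this permutation is ℓ+1, then an increasing sequence missing
-- ℓ and ℓ+1, then ℓ; each of its inversions involves the first or the last entry, which no
-- pattern of 𝒫 allows.

module Submission where

open import Defs
open import Data.Nat using (ℕ; zero; suc; _+_; _∸_; _≤_; _<_; z≤n; s≤s)
open import Data.Nat.Properties
open import Data.List using (List; []; _∷_; _++_; map; length; upTo)
open import Data.List.Properties using (≡-dec; ∷-injectiveˡ; length-upTo; ++-assoc; ++-identityʳ; map-++; map-id; upTo-∷ʳ)
open import Data.List.Membership.Propositional using (_∈_)
open import Data.List.Membership.DecPropositional (≡-dec _≟_) using (_∈?_)
open import Data.List.Membership.Propositional.Properties using (∈-upTo⁻)
open import Data.List.Relation.Unary.Any using (here; there)
open import Data.List.Relation.Unary.All using (All; []; _∷_)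
import Data.List.Relation.Unary.All as All
import Data.List.Relation.Unary.All.Properties as All
open import Data.List.Relation.Unary.AllPairs using (AllPairs; []; _∷_)
import Data.List.Relation.Unary.AllPairs as AllPairs
import Data.List.Relation.Unary.AllPairs.Properties as AllPairs
open import Data.List.Relation.Unary.Linked using (Linked; []; [-]; _∷_)
import Data.List.Relation.Unary.Linked.Properties as Linked
open import Data.List.Relation.Unary.Unique.Propositional using (Unique)
import Data.List.Relation.Unary.Unique.Propositional.Properties as Unique
import Data.List.Relation.Unary.Sorted.TotalOrder.Properties as Sorted
open import Data.List.Relation.Binary.Pointwise using (Pointwise-≡⇒≡)
open import Data.List.Relation.Binary.Sublist.Heterogeneous using ([]; _∷_; _∷ʳ_)
open import Data.List.Relation.Binary.Sublist.Propositional using (_⊆_; from∈; minimum)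
open import Data.List.Relation.Binary.Sublist.Propositional.Properties using (All-resp-⊆; Any-resp-⊆; ++⁺; map⁺)
open import Data.List.Relation.Binary.Permutation.Propositional
  using (_↭_; ↭-refl; ↭-sym; ↭-prep; ↭-swap; ↭⇒↭ₛ; module PermutationReasoning)
open import Data.List.Relation.Binary.Permutation.Propositional.Properties
  using (∈-resp-↭; ↭-length; shift; ++-comm)
import Data.List.Relation.Binary.Permutation.Setoid.Properties as PermutationSetoid
open import Data.Product using (∃; _×_; _,_; proj₁; proj₂)
open import Data.Sum using (_⊎_; inj₁; inj₂)
open import Data.Empty using (⊥-elim)
open import Function.Bundles using (_⇔_; mk⇔; module Equivalence)
open import Function.Base using (_∘_)
open import Relation.Binary.Definitions using (tri<; tri≈; tri>)
open import Relation.Binary.PropositionalEquality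
  using (_≡_; _≢_; refl; sym; trans; cong; cong₂; subst; setoid; module ≡-Reasoning)
open import Relation.Nullary using (¬_)
open import Relation.Nullary.Decidable using (True; toWitness)

AllPairs-resp-⊆ : ∀ {A : Set} {R : A → A → Set} {xs ys : List A} →
  xs ⊆ ys → AllPairs R ys → AllPairs R xs
AllPairs-resp-⊆ [] [] = []
AllPairs-resp-⊆ (_ ∷ʳ p) (_ ∷ rs) = AllPairs-resp-⊆ p rs
AllPairs-resp-⊆ (refl ∷ p) (r ∷ rs) = All-resp-⊆ p r ∷ AllPairs-resp-⊆ p rs

-- Pairs (value in π, value in the pattern), as zipped in OrdIso.
Concordant : ℕ × ℕ → ℕ × ℕ → Set
Concordant (a , s) (b , t) = (a < b × s < t) ⊎ (b < a × t < s)

rising : ∀ {a b s t} → a < b → {True (s <? t)} → Concordant (a , s) (b , t)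
rising a<b {s<t} = inj₁ (a<b , toWitness s<t)

falling : ∀ {a b s t} → b < a → {True (t <? s)} → Concordant (a , s) (b , t)
falling b<a {t<s} = inj₂ (b<a , toWitness t<s)

concordant⇒⇔ : ∀ {p q} → Concordant p q → (proj₁ p < proj₁ q ⇔ proj₂ p < proj₂ q)
concordant⇒⇔ (inj₁ (a<b , s<t)) = mk⇔ (λ _ → s<t) (λ _ → a<b)
concordant⇒⇔ (inj₂ (b<a , t<s)) = mk⇔ (λ a<b → ⊥-elim (<-asym a<b b<a)) (λ s<t → ⊥-elim (<-asym s<t t<s))

concordant-sym : ∀ {p q} → Concordant p q → Concordant q p
concordant-sym (inj₁ c) = inj₂ c
concordant-sym (inj₂ c) = inj₁ c

OrderMatching : List (ℕ × ℕ) → Set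
OrderMatching ps = ∀ {p q} → p ∈ ps → q ∈ ps → (proj₁ p < proj₁ q ⇔ proj₂ p < proj₂ q)

concordant⇒orderMatching : ∀ {ps} → AllPairs Concordant ps → OrderMatching ps
concordant⇒orderMatching (_ ∷ _) (here refl) (here refl) =
  mk⇔ (λ a<a → ⊥-elim (<-irrefl refl a<a)) (λ s<s → ⊥-elim (<-irrefl refl s<s))
concordant⇒orderMatching (c ∷ _) (here refl) (there q) = concordant⇒⇔ (All.lookup c q)
concordant⇒orderMatching (c ∷ _) (there p) (here refl) = concordant⇒⇔ (concordant-sym (All.lookup c p))
concordant⇒orderMatching (_ ∷ cs) (there p) (there q) = concordant⇒orderMatching cs p q

concordant⇒contains : ∀ {π} (ps : List (ℕ × ℕ)) →
  map proj₁ ps ⊆ π → AllPairs Concordant ps → Contains π (map proj₂ ps)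
concordant⇒contains ps sub cs = _ , sub , ps , refl , refl , concordant⇒orderMatching cs

DescentReflected : ℕ × ℕ → ℕ × ℕ → Set
DescentReflected (a , s) (b , t) = t < s → b < a

descent : ∀ {a b s t} → DescentReflected (a , s) (b , t) → {True (t <? s)} → b < a
descent d {t<s} = d (toWitness t<s)

orderMatching⇒descentReflected : ∀ {ps} → OrderMatching ps → AllPairs DescentReflected ps
orderMatching⇒descentReflected {[]} iso = []
orderMatching⇒descentReflected {p ∷ ps} iso =
  All.tabulate (λ q∈ → Equivalence.from (iso (there q∈) (here refl))) ∷
  orderMatching⇒descentReflected (λ p∈ q∈ → iso (there p∈) (there q∈))

contains⁴⇒occurrence : ∀ {π t₁ t₂ t₃ t₄} → Contains π (t₁ ∷ t₂ ∷ t₃ ∷ t₄ ∷ []) →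
  ∃ λ w → ∃ λ x → ∃ λ y → ∃ λ z → (w ∷ x ∷ y ∷ z ∷ []) ⊆ π ×
    AllPairs DescentReflected ((w , t₁) ∷ (x , t₂) ∷ (y , t₃) ∷ (z , t₄) ∷ [])
contains⁴⇒occurrence (_ , sub , (_ ∷ _ ∷ _ ∷ _ ∷ []) , refl , refl , iso) =
  _ , _ , _ , _ , sub , orderMatching⇒descentReflected iso
contains⁴⇒occurrence (_ , _ , [] , _ , () , _)
contains⁴⇒occurrence (_ , _ , (_ ∷ []) , _ , () , _)
contains⁴⇒occurrence (_ , _ , (_ ∷ _ ∷ []) , _ , () , _)
contains⁴⇒occurrence (_ , _ , (_ ∷ _ ∷ _ ∷ []) , _ , () , _)
contains⁴⇒occurrence (_ , _ , (_ ∷ _ ∷ _ ∷ _ ∷ _ ∷ _) , _ , () , _)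

entry : ∀ {xs : List ℕ} → xs ≢ [] → ∃ (_∈ xs)
entry {[]} ne = ⊥-elim (ne refl)
entry {x ∷ _} _ = x , here refl

perm-length : ∀ {n π} → IsPerm n π → length π ≡ n
perm-length {n} perm = trans (↭-length perm) (length-upTo n)

nonempty⇒1≤length : ∀ {xs : List ℕ} → xs ≢ [] → 1 ≤ length xs
nonempty⇒1≤length {[]} ne = ⊥-elim (ne refl)
nonempty⇒1≤length {_ ∷ _} _ = s≤s z≤n

perm-entry< : ∀ {n α x} → IsPerm n α → x ∈ α → x < n
perm-entry< perm x∈ = ∈-upTo⁻ (∈-resp-↭ perm x∈)

perm-unique : ∀ {n α} → IsPerm n α → Unique α
perm-unique {n} perm = PermutationSetoid.Unique-resp-↭ (setoid ℕ) (↭⇒↭ₛ (↭-sym perm)) (Unique.upTo⁺ n)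

perm-pair-distinct : ∀ {n α u v} → IsPerm n α → (u ∷ v ∷ []) ⊆ α → u ≢ v
perm-pair-distinct perm uv with AllPairs-resp-⊆ uv (perm-unique perm)
... | (u≢v ∷ []) ∷ _ = u≢v

perm-singleton : ∀ {α} → IsPerm (length α) α → α ≢ [] → (∀ {u v} → ¬ (u ∷ v ∷ []) ⊆ α) → α ≡ 0 ∷ []
perm-singleton {[]} _ ne _ = ⊥-elim (ne refl)
perm-singleton {x ∷ []} perm _ _ = cong (_∷ []) (n<1⇒n≡0 (perm-entry< perm (here refl)))
perm-singleton {_ ∷ _ ∷ xs} _ _ no-pair = ⊥-elim (no-pair (refl ∷ refl ∷ minimum xs))

upTo-+ : ∀ a b → upTo (a + b) ≡ upTo a ++ map (a +_) (upTo b)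
upTo-+ a zero = trans (cong upTo (+-identityʳ a)) (sym (++-identityʳ (upTo a)))
upTo-+ a (suc b) = begin
    upTo (a + suc b)
  ≡⟨ cong upTo (+-suc a b) ⟩
    upTo (suc (a + b))
  ≡⟨ upTo-∷ʳ (a + b) ⟨
    upTo (a + b) ++ a + b ∷ []
  ≡⟨ cong (_++ a + b ∷ []) (upTo-+ a b) ⟩
    (upTo a ++ map (a +_) (upTo b)) ++ a + b ∷ []
  ≡⟨ ++-assoc (upTo a) _ _ ⟩
    upTo a ++ map (a +_) (upTo b) ++ a + b ∷ []
  ≡⟨ cong (upTo a ++_) (map-++ (a +_) (upTo b) (b ∷ [])) ⟨
    upTo a ++ map (a +_) (upTo b ++ b ∷ [])
  ≡⟨ cong (λ bs → upTo a ++ map (a +_) bs) (upTo-∷ʳ b) ⟩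
    upTo a ++ map (a +_) (upTo (suc b))
  ∎
  where open ≡-Reasoning

upTo-increasing : ∀ n → AllPairs _<_ (upTo n)
upTo-increasing n = AllPairs.applyUpTo⁺₁ (λ i → i) n (λ i<j _ → i<j)

nondescending⇒sorted : ∀ {α} → (∀ {u v} → (u ∷ v ∷ []) ⊆ α → ¬ v < u) → Linked _≤_ α
nondescending⇒sorted {[]} _ = []
nondescending⇒sorted {_ ∷ []} _ = [-]
nondescending⇒sorted {_ ∷ _ ∷ xs} nd =
  ≮⇒≥ (nd (refl ∷ refl ∷ minimum xs)) ∷ nondescending⇒sorted (λ uv → nd (_ ∷ʳ uv))

nondescending-perm : ∀ {α} → IsPerm (length α) α → (∀ {u v} → (u ∷ v ∷ []) ⊆ α → ¬ v < u) →
  α ≡ upTo (length α)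
nondescending-perm {α} perm nd = Pointwise-≡⇒≡
  (Sorted.↗↭↗⇒≋ ≤-totalOrder (nondescending⇒sorted nd)
    (Linked.applyUpTo⁺₁ (λ i → i) (length α) (λ _ → n≤1+n _)) (↭⇒↭ₛ perm))

Separated : ℕ → ℕ → Set
Separated ℓ m = m < ℓ ⊎ suc ℓ < m

-- The relation between an entry u and a later entry v of a list suc ℓ ∷ M ++ ℓ ∷ [] with M
-- increasing and Separated ℓ: every inversion involves the first or the last entry.
record Framed (ℓ u v : ℕ) : Set where
  field
    earlier≢last : u ≢ ℓ
    later≢first : v ≢ suc ℓ
    ordered : u < v ⊎ u ≡ suc ℓ ⊎ v ≡ ℓ

open Framed

framed-allPairs : ∀ {ℓ M} → AllPairs _<_ M → All (Separated ℓ) M →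
  AllPairs (Framed ℓ) (suc ℓ ∷ M ++ ℓ ∷ [])
framed-allPairs {ℓ} increasing separated =
  All.++⁺ (All.map from-first separated) (first-to-last ∷ []) ∷ middle increasing separated
  where
  separated⇒≢last : ∀ {m} → Separated ℓ m → m ≢ ℓ
  separated⇒≢last (inj₁ m<ℓ) refl = <-irrefl refl m<ℓ
  separated⇒≢last (inj₂ ℓ<m) refl = <-asym ℓ<m (n<1+n ℓ)

  separated⇒≢first : ∀ {m} → Separated ℓ m → m ≢ suc ℓ
  separated⇒≢first (inj₁ m<ℓ) refl = <-asym m<ℓ (n<1+n ℓ)
  separated⇒≢first (inj₂ ℓ<m) refl = <-irrefl refl ℓ<m

  from-first : ∀ {m} → Separated ℓ m → Framed ℓ (suc ℓ) m
  from-first s =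
    record { earlier≢last = 1+n≢n ; later≢first = separated⇒≢first s ; ordered = inj₂ (inj₁ refl) }

  first-to-last : Framed ℓ (suc ℓ) ℓ
  first-to-last = record { earlier≢last = 1+n≢n ; later≢first = 1+n≢n ∘ sym ; ordered = inj₂ (inj₁ refl) }

  to-last : ∀ {m} → Separated ℓ m → Framed ℓ m ℓ
  to-last s =
    record { earlier≢last = separated⇒≢last s ; later≢first = 1+n≢n ∘ sym ; ordered = inj₂ (inj₂ refl) }

  increasing-pair : ∀ {m m′} → Separated ℓ m → Separated ℓ m′ → m < m′ → Framed ℓ m m′
  increasing-pair s s′ m<m′ =
    record { earlier≢last = separated⇒≢last s ; later≢first = separated⇒≢first s′ ; ordered = inj₁ m<m′ }

  middle : ∀ {M} → AllPairs _<_ M → All (Separated ℓ) M → AllPairs (Framed ℓ) (M ++ ℓ ∷ [])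
  middle [] [] = [] ∷ []
  middle (m< ∷ increasing) (s ∷ separated) =
    All.++⁺ (All.zipWith (λ (s′ , m<m′) → increasing-pair s s′ m<m′) (separated , m<)) (to-last s ∷ [])
    ∷ middle increasing separated

no-inner-inversion : ∀ {ℓ w x y z} → Framed ℓ w x → Framed ℓ x y → Framed ℓ y z → ¬ y < x
no-inner-inversion wx xy yz y<x with ordered xy
... | inj₁ x<y = <-asym x<y y<x
... | inj₂ (inj₁ x≡) = later≢first wx x≡
... | inj₂ (inj₂ y≡) = earlier≢last yz y≡

no-321 : ∀ {ℓ a b c} → Framed ℓ a b → Framed ℓ b c → b < a → ¬ c < b
no-321 ab bc b<a c<b with ordered ab | ordered bc
... | inj₁ a<b | _ = <-asym a<b b<a
... | inj₂ (inj₂ b≡) | _ = earlier≢last bc b≡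
... | _ | inj₁ b<c = <-asym b<c c<b
... | _ | inj₂ (inj₁ b≡) = later≢first ab b≡
... | inj₂ (inj₁ refl) | inj₂ (inj₂ refl) = <⇒≱ c<b (≤-pred b<a)

module _ {ℓ π} (framed : AllPairs (Framed ℓ) π) where

  framed-no-inner-inversion : ∀ {t₁ t₂ t₃ t₄} → {True (t₃ <? t₂)} →
    ¬ Contains π (t₁ ∷ t₂ ∷ t₃ ∷ t₄ ∷ [])
  framed-no-inner-inversion {_} {_} {_} {_} {t₃<t₂} c with contains⁴⇒occurrence c
  ... | _ , _ , _ , _ , sub , (_ ∷ (dxy ∷ _) ∷ _)
    with AllPairs-resp-⊆ sub framed
  ...   | (wx ∷ _) ∷ (xy ∷ _) ∷ (yz ∷ []) ∷ _ = no-inner-inversion wx xy yz (descent dxy {t₃<t₂})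

  framed-no-321 : ∀ {t₁ t₂ t₃ t₄} → {True (t₂ <? t₁)} → {True (t₄ <? t₂)} →
    ¬ Contains π (t₁ ∷ t₂ ∷ t₃ ∷ t₄ ∷ [])
  framed-no-321 {_} {_} {_} {_} {t₂<t₁} {t₄<t₂} c with contains⁴⇒occurrence c
  ... | _ , _ , _ , _ , sub , ((dwx ∷ _) ∷ (_ ∷ dxz ∷ []) ∷ _)
    with AllPairs-resp-⊆ sub framed
  ...   | (wx ∷ _) ∷ (_ ∷ xz ∷ []) ∷ _ = no-321 wx xz (descent dwx {t₂<t₁}) (descent dxz {t₄<t₂})

  -- Every pattern of 𝒫 except 4231 has an inversion between its two middle entries; 4231 contains 421.
  framed-avoids-𝒫 : Avoids π 𝒫
  framed-avoids-𝒫 (here refl) = framed-no-inner-inversion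
  framed-avoids-𝒫 (there (here refl)) = framed-no-inner-inversion
  framed-avoids-𝒫 (there (there (here refl))) = framed-no-inner-inversion
  framed-avoids-𝒫 (there (there (there (here refl)))) = framed-no-inner-inversion
  framed-avoids-𝒫 (there (there (there (there (here refl))))) = framed-no-inner-inversion
  framed-avoids-𝒫 (there (there (there (there (there (here refl)))))) = framed-no-321
  framed-avoids-𝒫 (there (there (there (there (there (there (here refl))))))) = framed-no-inner-inversion
  framed-avoids-𝒫 (there (there (there (there (there (there (there (here refl)))))))) = framed-no-inner-inversion

inflate3142 : List ℕ → List ℕ → List ℕ → List ℕ → List ℕ
inflate3142 α₁ α₂ α₃ α₄ = inflate σ3142 (α₁ ∷ α₂ ∷ α₃ ∷ α₄ ∷ [])

gapped : ℕ → ℕ → List ℕ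
gapped ℓ m = upTo ℓ ++ map (suc (suc ℓ) +_) (upTo m)

special-form : ∀ ℓ m → inflate3142 (0 ∷ []) (upTo ℓ) (upTo m) (0 ∷ []) ≡ suc ℓ ∷ gapped ℓ m ++ ℓ ∷ []
special-form ℓ m rewrite length-upTo ℓ = cong₂ _∷_ (trans (+-identityʳ (ℓ + 1)) ℓ+1≡1+ℓ) (begin
    map (0 +_) (upTo ℓ) ++ map (suc (ℓ + 1) +_) (upTo m) ++ ℓ + 0 + 0 ∷ []
  ≡⟨ cong₂ _++_ (map-id (upTo ℓ))
       (cong₂ (λ k z → map (suc k +_) (upTo m) ++ z ∷ []) ℓ+1≡1+ℓ (trans (+-identityʳ _) (+-identityʳ ℓ))) ⟩
    upTo ℓ ++ map (suc (suc ℓ) +_) (upTo m) ++ ℓ ∷ []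
  ≡⟨ ++-assoc (upTo ℓ) _ _ ⟨
    gapped ℓ m ++ ℓ ∷ []
  ∎)
  where
  open ≡-Reasoning
  ℓ+1≡1+ℓ : ℓ + 1 ≡ suc ℓ
  ℓ+1≡1+ℓ = +-comm ℓ 1

gapped-perm : ∀ ℓ m → suc ℓ ∷ gapped ℓ m ++ ℓ ∷ [] ↭ upTo (suc (suc ℓ) + m)
gapped-perm ℓ m = begin
    suc ℓ ∷ (lo ++ hi) ++ ℓ ∷ []
  ↭⟨ ↭-prep (suc ℓ) (++-comm (lo ++ hi) (ℓ ∷ [])) ⟩
    suc ℓ ∷ ℓ ∷ lo ++ hi
  ↭⟨ ↭-swap (suc ℓ) ℓ ↭-refl ⟩
    ℓ ∷ suc ℓ ∷ lo ++ hi
  ↭⟨ ↭-prep ℓ (shift (suc ℓ) lo hi) ⟨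
    ℓ ∷ lo ++ suc ℓ ∷ hi
  ↭⟨ shift ℓ lo (suc ℓ ∷ hi) ⟨
    lo ++ ℓ ∷ suc ℓ ∷ hi
  ≡⟨ ++-assoc lo (ℓ ∷ suc ℓ ∷ []) hi ⟨
    (lo ++ ℓ ∷ suc ℓ ∷ []) ++ hi
  ≡⟨ cong (_++ hi) upTo-2+ℓ ⟨
    upTo (suc (suc ℓ)) ++ hi
  ≡⟨ upTo-+ (suc (suc ℓ)) m ⟨
    upTo (suc (suc ℓ) + m)
  ∎
  where
  open PermutationReasoning
  lo hi : List ℕ
  lo = upTo ℓ
  hi = map (suc (suc ℓ) +_) (upTo m)
  upTo-2+ℓ : upTo (suc (suc ℓ)) ≡ lo ++ ℓ ∷ suc ℓ ∷ []
  upTo-2+ℓ = trans (sym (upTo-∷ʳ (suc ℓ)))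
               (trans (cong (_++ suc ℓ ∷ []) (sym (upTo-∷ʳ ℓ))) (++-assoc lo (ℓ ∷ []) (suc ℓ ∷ [])))

gapped-increasing : ∀ ℓ m → AllPairs _<_ (gapped ℓ m)
gapped-increasing ℓ m = AllPairs.++⁺ (upTo-increasing ℓ)
  (AllPairs.map⁺ (AllPairs.map (+-monoʳ-< (suc (suc ℓ))) (upTo-increasing m)))
  (All.tabulate λ x∈ → All.map⁺ (All.universal (low<high x∈) (upTo m)))
  where
  low<high : ∀ {x} → x ∈ upTo ℓ → ∀ i → x < suc (suc ℓ) + i
  low<high x∈ i = <-≤-trans (∈-upTo⁻ x∈) (≤-trans (m≤n+m ℓ 2) (m≤m+n (2 + ℓ) i))

gapped-separated : ∀ ℓ m → All (Separated ℓ) (gapped ℓ m)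
gapped-separated ℓ m = All.++⁺ (All.tabulate (inj₁ ∘ ∈-upTo⁻))
  (All.map⁺ (All.universal (λ i → inj₂ (s≤s (s≤s (m≤m+n ℓ i)))) (upTo m)))

special-avoids-𝒫 : ∀ ℓ m → Avoids (inflate3142 (0 ∷ []) (upTo ℓ) (upTo m) (0 ∷ [])) 𝒫
special-avoids-𝒫 ℓ m = framed-avoids-𝒫 (subst (AllPairs (Framed ℓ)) (sym (special-form ℓ m))
  (framed-allPairs (gapped-increasing ℓ m) (gapped-separated ℓ m)))

special-perm : ∀ ℓ m → IsPerm (suc (suc ℓ) + m) (inflate3142 (0 ∷ []) (upTo ℓ) (upTo m) (0 ∷ []))
special-perm ℓ m = subst (_↭ upTo (suc (suc ℓ) + m)) (sym (special-form ℓ m)) (gapped-perm ℓ m)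

shifted-< : ∀ {o L o′ u} v → o + L ≤ o′ → u < L → o + u < o′ + v
shifted-< {o} {o′ = o′} v o+L≤o′ u<L = ≤-trans (+-monoʳ-< o u<L) (≤-trans o+L≤o′ (m≤m+n o′ v))

2+ℓ+m∸ℓ∸2≡m : ∀ ℓ m → suc (suc ℓ) + m ∸ ℓ ∸ 2 ≡ m
2+ℓ+m∸ℓ∸2≡m zero m = refl
2+ℓ+m∸ℓ∸2≡m (suc ℓ) m = 2+ℓ+m∸ℓ∸2≡m ℓ m

ℓ≤2+ℓ+m∸3 : ∀ ℓ {m} → 1 ≤ m → ℓ ≤ suc (suc ℓ) + m ∸ 3
ℓ≤2+ℓ+m∸3 ℓ {suc m} _ = subst (λ k → ℓ ≤ k ∸ 1) (sym (+-suc ℓ m)) (m≤m+n ℓ m)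

ℓ≤n∸3⇒n≡2+ℓ+m : ∀ {n ℓ} → 4 ≤ n → ℓ ≤ n ∸ 3 → ∃ λ m → 1 ≤ m × n ≡ suc (suc ℓ) + m
ℓ≤n∸3⇒n≡2+ℓ+m {ℓ = ℓ} (s≤s (s≤s (s≤s _))) ℓ≤n∸3 with m≤n⇒∃[o]m+o≡n ℓ≤n∸3
... | k , refl = suc k , s≤s z≤n , cong (suc ∘ suc) (sym (+-suc ℓ k))

special≡ : ∀ ℓ m → special (suc (suc ℓ) + m) ℓ ≡ inflate3142 (0 ∷ []) (upTo ℓ) (upTo m) (0 ∷ [])
special≡ ℓ m = cong (λ k → inflate3142 (0 ∷ []) (upTo ℓ) (upTo k) (0 ∷ [])) (2+ℓ+m∸ℓ∸2≡m ℓ m)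

special-injective : ∀ n ℓ ℓ′ → special n ℓ ≡ special n ℓ′ → ℓ ≡ ℓ′
special-injective n ℓ ℓ′ e = suc-injective (∷-injectiveˡ
  (trans (sym (special-form ℓ (n ∸ ℓ ∸ 2))) (trans e (special-form ℓ′ (n ∸ ℓ′ ∸ 2)))))

pattern∈𝒫 : ∀ {τ} → {True (τ ∈? 𝒫)} → τ ∈ 𝒫
pattern∈𝒫 {τ} {τ∈𝒫} = toWitness τ∈𝒫

module Classification
  {α₁ α₂ α₃ α₄ : List ℕ}
  (nonempty₁ : α₁ ≢ []) (nonempty₂ : α₂ ≢ []) (nonempty₃ : α₃ ≢ []) (nonempty₄ : α₄ ≢ [])
  (perm₁ : IsPerm (length α₁) α₁) (perm₂ : IsPerm (length α₂) α₂)
  (perm₃ : IsPerm (length α₃) α₃) (perm₄ : IsPerm (length α₄) α₄)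
  (avoid : Avoids (inflate3142 α₁ α₂ α₃ α₄) 𝒫)
  where

  L₁ L₂ L₃ L₄ : ℕ
  L₁ = length α₁
  L₂ = length α₂
  L₃ = length α₃
  L₄ = length α₄

  -- The offsets by which inflate shifts blocks 1, 3 and 4; block 2 is shifted by 0.
  o₁ o₃ o₄ : ℕ
  o₁ = L₂ + (L₄ + 0)
  o₃ = L₁ + o₁
  o₄ = L₂ + 0

  select : ∀ {s₁ s₂ s₃ s₄} → s₁ ⊆ α₁ → s₂ ⊆ α₂ → s₃ ⊆ α₃ → s₄ ⊆ α₄ →
    map (o₁ +_) s₁ ++ map (0 +_) s₂ ++ map (o₃ +_) s₃ ++ map (o₄ +_) s₄ ++ [] ⊆ inflate3142 α₁ α₂ α₃ α₄
  select s₁ s₂ s₃ s₄ = ++⁺ (map⁺ _ s₁) (++⁺ (map⁺ _ s₂) (++⁺ (map⁺ _ s₃) (++⁺ (map⁺ _ s₄) [])))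

  block₂<block₄ : ∀ {c} d → c ∈ α₂ → c < o₄ + d
  block₂<block₄ d c∈ = shifted-< {0} d (≤-reflexive (sym (+-identityʳ L₂))) (perm-entry< perm₂ c∈)

  block₂<block₁ : ∀ {c} x → c ∈ α₂ → c < o₁ + x
  block₂<block₁ x c∈ = shifted-< {0} x (m≤m+n L₂ _) (perm-entry< perm₂ c∈)

  o₄+L₄≡o₁ : o₄ + L₄ ≡ o₁
  o₄+L₄≡o₁ = trans (+-assoc L₂ 0 L₄) (cong (L₂ +_) (sym (+-identityʳ L₄)))

  block₄<block₁ : ∀ {d} x → d ∈ α₄ → o₄ + d < o₁ + x
  block₄<block₁ x d∈ = shifted-< x (≤-reflexive o₄+L₄≡o₁) (perm-entry< perm₄ d∈)

  block₄<block₃ : ∀ {d} e → d ∈ α₄ → o₄ + d < o₃ + e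
  block₄<block₃ e d∈ = shifted-< e (≤-trans (≤-reflexive o₄+L₄≡o₁) (m≤n+m o₁ L₁)) (perm-entry< perm₄ d∈)

  block₁<block₃ : ∀ {x} e → x ∈ α₁ → o₁ + x < o₃ + e
  block₁<block₃ e x∈ = shifted-< e (≤-reflexive (+-comm o₁ L₁)) (perm-entry< perm₁ x∈)

  no-pair-in-block₁ : ∀ {u v} → ¬ (u ∷ v ∷ []) ⊆ α₁
  no-pair-in-block₁ {u} {v} uv with entry nonempty₂ | entry nonempty₄ | <-cmp u v
  ... | c , c∈ | d , d∈ | tri< u<v _ _ = avoid pattern∈𝒫 (concordant⇒contains
    ((o₁ + u , 3) ∷ (o₁ + v , 4) ∷ (c , 1) ∷ (o₄ + d , 2) ∷ [])
    (select uv (from∈ c∈) (minimum _) (from∈ d∈))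
    ((rising (+-monoʳ-< o₁ u<v) ∷ falling (block₂<block₁ u c∈) ∷ falling (block₄<block₁ u d∈) ∷ []) ∷
     (falling (block₂<block₁ v c∈) ∷ falling (block₄<block₁ v d∈) ∷ []) ∷
     (rising (block₂<block₄ d c∈) ∷ []) ∷ [] ∷ []))
  ... | _ | _ | tri≈ _ u≡v _ = perm-pair-distinct perm₁ uv u≡v
  ... | c , c∈ | d , d∈ | tri> _ _ v<u = avoid pattern∈𝒫 (concordant⇒contains
    ((o₁ + u , 4) ∷ (o₁ + v , 3) ∷ (c , 1) ∷ (o₄ + d , 2) ∷ [])
    (select uv (from∈ c∈) (minimum _) (from∈ d∈))
    ((falling (+-monoʳ-< o₁ v<u) ∷ falling (block₂<block₁ u c∈) ∷ falling (block₄<block₁ u d∈) ∷ []) ∷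
     (falling (block₂<block₁ v c∈) ∷ falling (block₄<block₁ v d∈) ∷ []) ∷
     (rising (block₂<block₄ d c∈) ∷ []) ∷ [] ∷ []))

  no-pair-in-block₄ : ∀ {u v} → ¬ (u ∷ v ∷ []) ⊆ α₄
  no-pair-in-block₄ {u} {v} uv with entry nonempty₁ | entry nonempty₃ | <-cmp u v
  ... | x , x∈ | e , e∈ | tri< u<v _ _ = avoid pattern∈𝒫 (concordant⇒contains
    ((o₁ + x , 3) ∷ (o₃ + e , 4) ∷ (o₄ + u , 1) ∷ (o₄ + v , 2) ∷ [])
    (select (from∈ x∈) (minimum _) (from∈ e∈) uv)
    ((rising (block₁<block₃ e x∈) ∷ falling (block₄<block₁ x u∈) ∷ falling (block₄<block₁ x v∈) ∷ []) ∷
     (falling (block₄<block₃ e u∈) ∷ falling (block₄<block₃ e v∈) ∷ []) ∷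
     (rising (+-monoʳ-< o₄ u<v) ∷ []) ∷ [] ∷ []))
    where
    u∈ = Any-resp-⊆ uv (here refl)
    v∈ = Any-resp-⊆ uv (there (here refl))
  ... | _ | _ | tri≈ _ u≡v _ = perm-pair-distinct perm₄ uv u≡v
  ... | x , x∈ | e , e∈ | tri> _ _ v<u = avoid pattern∈𝒫 (concordant⇒contains
    ((o₁ + x , 3) ∷ (o₃ + e , 4) ∷ (o₄ + u , 2) ∷ (o₄ + v , 1) ∷ [])
    (select (from∈ x∈) (minimum _) (from∈ e∈) uv)
    ((rising (block₁<block₃ e x∈) ∷ falling (block₄<block₁ x u∈) ∷ falling (block₄<block₁ x v∈) ∷ []) ∷
     (falling (block₄<block₃ e u∈) ∷ falling (block₄<block₃ e v∈) ∷ []) ∷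
     (falling (+-monoʳ-< o₄ v<u) ∷ []) ∷ [] ∷ []))
    where
    u∈ = Any-resp-⊆ uv (here refl)
    v∈ = Any-resp-⊆ uv (there (here refl))

  no-descent-in-block₂ : ∀ {u v} → (u ∷ v ∷ []) ⊆ α₂ → ¬ v < u
  no-descent-in-block₂ {u} {v} uv v<u with entry nonempty₁ | entry nonempty₄
  ... | x , x∈ | d , d∈ = avoid pattern∈𝒫 (concordant⇒contains
    ((o₁ + x , 4) ∷ (u , 2) ∷ (v , 1) ∷ (o₄ + d , 3) ∷ [])
    (select (from∈ x∈) uv (minimum _) (from∈ d∈))
    ((falling (block₂<block₁ x u∈) ∷ falling (block₂<block₁ x v∈) ∷ falling (block₄<block₁ x d∈) ∷ []) ∷
     (falling v<u ∷ rising (block₂<block₄ d u∈) ∷ []) ∷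
     (rising (block₂<block₄ d v∈) ∷ []) ∷ [] ∷ []))
    where
    u∈ = Any-resp-⊆ uv (here refl)
    v∈ = Any-resp-⊆ uv (there (here refl))

  no-descent-in-block₃ : ∀ {u v} → (u ∷ v ∷ []) ⊆ α₃ → ¬ v < u
  no-descent-in-block₃ {u} {v} uv v<u with entry nonempty₁ | entry nonempty₄
  ... | x , x∈ | d , d∈ = avoid pattern∈𝒫 (concordant⇒contains
    ((o₁ + x , 2) ∷ (o₃ + u , 4) ∷ (o₃ + v , 3) ∷ (o₄ + d , 1) ∷ [])
    (select (from∈ x∈) (minimum _) uv (from∈ d∈))
    ((rising (block₁<block₃ u x∈) ∷ rising (block₁<block₃ v x∈) ∷ falling (block₄<block₁ x d∈) ∷ []) ∷
     (falling (+-monoʳ-< o₃ v<u) ∷ falling (block₄<block₃ u d∈) ∷ []) ∷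
     (falling (block₄<block₃ v d∈) ∷ []) ∷ [] ∷ []))

  block₁≡[0] : α₁ ≡ 0 ∷ []
  block₁≡[0] = perm-singleton perm₁ nonempty₁ no-pair-in-block₁

  block₄≡[0] : α₄ ≡ 0 ∷ []
  block₄≡[0] = perm-singleton perm₄ nonempty₄ no-pair-in-block₄

  block₂≡upTo : α₂ ≡ upTo (length α₂)
  block₂≡upTo = nondescending-perm perm₂ no-descent-in-block₂

  block₃≡upTo : α₃ ≡ upTo (length α₃)
  block₃≡upTo = nondescending-perm perm₃ no-descent-in-block₃

  blocks-normal : inflate3142 α₁ α₂ α₃ α₄ ≡ inflate3142 (0 ∷ []) (upTo L₂) (upTo L₃) (0 ∷ [])
  blocks-normal = trans (cong₂ (λ a d → inflate3142 a α₂ α₃ d) block₁≡[0] block₄≡[0])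
                        (cong₂ (λ b c → inflate3142 (0 ∷ []) b c (0 ∷ [])) block₂≡upTo block₃≡upTo)

  classification : ∀ {n} → IsPerm n (inflate3142 α₁ α₂ α₃ α₄) →
    ∃ λ ℓ → 1 ≤ ℓ × ℓ ≤ n ∸ 3 × inflate3142 α₁ α₂ α₃ α₄ ≡ special n ℓ
  classification perm
    with trans (sym (perm-length perm)) (perm-length (subst (IsPerm _) (sym blocks-normal) (special-perm L₂ L₃)))
  ... | refl = L₂ , nonempty⇒1≤length nonempty₂ , ℓ≤2+ℓ+m∸3 L₂ (nonempty⇒1≤length nonempty₃) ,
               trans blocks-normal (sym (special≡ L₂ L₃))

special⇒avoiding-inflation : ∀ {n π} → 4 ≤ n → (∃ λ ℓ → 1 ≤ ℓ × ℓ ≤ n ∸ 3 × π ≡ special n ℓ) →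
  IsPerm n π × IsInflationOf σ3142 π × Avoids π 𝒫
special⇒avoiding-inflation 4≤n (ℓ , 1≤ℓ , ℓ≤n∸3 , refl) with ℓ≤n∸3⇒n≡2+ℓ+m 4≤n ℓ≤n∸3
... | m , 1≤m , refl rewrite special≡ ℓ m =
  special-perm ℓ m ,
  (((0 ∷ []) ∷ upTo ℓ ∷ upTo m ∷ (0 ∷ []) ∷ []) , refl ,
    (((λ ()) , ↭-refl) ∷ upTo-block 1≤ℓ ∷ upTo-block 1≤m ∷ ((λ ()) , ↭-refl) ∷ []) , refl) ,
  special-avoids-𝒫 ℓ m
  where
  upTo-block : ∀ {k} → 1 ≤ k → upTo k ≢ [] × IsPerm (length (upTo k)) (upTo k)
  upTo-block {suc k} _ = (λ ()) , subst (λ j → upTo (suc k) ↭ upTo j) (sym (length-upTo (suc k))) ↭-refl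

avoiding-inflation⇒special : ∀ {n π} → IsPerm n π × IsInflationOf σ3142 π × Avoids π 𝒫 →
  ∃ λ ℓ → 1 ≤ ℓ × ℓ ≤ n ∸ 3 × π ≡ special n ℓ
avoiding-inflation⇒special
  (perm , ((_ ∷ _ ∷ _ ∷ _ ∷ []) , refl , ((ne₁ , p₁) ∷ (ne₂ , p₂) ∷ (ne₃ , p₃) ∷ (ne₄ , p₄) ∷ []) , refl) , avoid) =
  Classification.classification ne₁ ne₂ ne₃ ne₄ p₁ p₂ p₃ p₄ avoid perm
avoiding-inflation⇒special (_ , ([] , () , _) , _)
avoiding-inflation⇒special (_ , ((_ ∷ []) , () , _) , _)
avoiding-inflation⇒special (_ , ((_ ∷ _ ∷ []) , () , _) , _)
avoiding-inflation⇒special (_ , ((_ ∷ _ ∷ _ ∷ []) , () , _) , _)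
avoiding-inflation⇒special (_ , ((_ ∷ _ ∷ _ ∷ _ ∷ _ ∷ _) , () , _) , _)

mainTheorem13 : (n : ℕ) → 4 ≤ n →
    ((π : List ℕ) →
      (IsPerm n π × IsInflationOf σ3142 π × Avoids π 𝒫)
        ⇔ (∃ λ ℓ → 1 ≤ ℓ × ℓ ≤ n ∸ 3 × π ≡ special n ℓ))
    × ((ℓ ℓ′ : ℕ) → 1 ≤ ℓ → ℓ ≤ n ∸ 3 → 1 ≤ ℓ′ → ℓ′ ≤ n ∸ 3 →
        special n ℓ ≡ special n ℓ′ → ℓ ≡ ℓ′)
mainTheorem13 n 4≤n =
  (λ π → mk⇔ avoiding-inflation⇒special (special⇒avoiding-inflation 4≤n)) ,
  (λ ℓ ℓ′ _ _ _ _ → special-injective n ℓ ℓ′)
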